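{- In $GP(2k+1,2)$, for odd $r$, there are exactly two geodesics between $u_0$ and $u_r$ when $5<r<k$, and exactly three when $r=k$ (with $r>5$); all of them pass through inner vertices.
   Context: For an integer $n\ge 5$, $GP(n,2)$ is the graph with vertex set $\{u_0,\dots,u_{n-1},v_0,\dots,v_{n-1}\}$ and edges $u_iu_{i+1}$ (outer edges), $u_iv_i$ (spokes) and $v_iv_{i+2}$ (inner edges) for $0\le i\le n-1$, subscripts modulo $n$. The $u_i$ are outer vertices, the $v_i$ inner vertices. A geodesic is a shortest path. -}

module Defs where

open import Data.Nat using (ℕ; suc; _+_; _*_; _≤_; NonZero)
open import Data.Nat.DivMod using (_mod_)
open import Data.Fin using (Fin; toℕ)
open import Data.List using (List; length; head; last)
open import Data.List.Relation.Unary.Linked using (Linked)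
open import Data.List.Relation.Unary.Any using (Any)
open import Data.List.Relation.Unary.All using (All)
open import Data.List.Relation.Unary.Unique.Propositional using (Unique)
open import Data.List.Membership.Propositional using (_∈_)
open import Data.Maybe using (just)
open import Data.Product using (_×_; ∃-syntax)
open import Relation.Binary.PropositionalEquality using (_≡_)

data V (n : ℕ) : Set where
  u : Fin n → V n
  v : Fin n → V n

_⊕_ : ∀ {n} .{{_ : NonZero n}} → Fin n → ℕ → Fin n
_⊕_ {n} i a = (toℕ i + a) mod n

uₙ : (n : ℕ) .{{_ : NonZero n}} → ℕ → V n
uₙ n i = u (i mod n)

data Adj {n : ℕ} .{{_ : NonZero n}} : V n → V n → Set where
  outer→ : ∀ i → Adj (u i) (u (i ⊕ 1))
  outer← : ∀ i → Adj (u (i ⊕ 1)) (u i)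
  spoke→ : ∀ i → Adj (u i) (v i)
  spoke← : ∀ i → Adj (v i) (u i)
  inner→ : ∀ i → Adj (v i) (v (i ⊕ 2))
  inner← : ∀ i → Adj (v (i ⊕ 2)) (v i)

isInner : ∀ {n} → V n → Set
isInner {n} x = ∃[ i ] x ≡ v i

-- A walk from x to y: a nonempty list of vertices, consecutive ones adjacent,
-- starting at x and ending at y. Its length (number of edges) is length − 1.
IsWalk : ∀ {n} .{{_ : NonZero n}} → V n → V n → List (V n) → Set
IsWalk x y p = Linked Adj p × head p ≡ just x × last p ≡ just y

-- A geodesic: a walk from x to y of minimum length among all walks from x to y
-- (such a walk is necessarily a path, i.e. has no repeated vertices).
IsGeodesic : ∀ {n} .{{_ : NonZero n}} → V n → V n → List (V n) → Set
IsGeodesic {n} x y p =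
  IsWalk x y p × (∀ (q : List (V n)) → IsWalk x y q → length p ≤ length q)

ExactlyGeodesics : ∀ {n} .{{_ : NonZero n}} → ℕ → V n → V n → Set
ExactlyGeodesics {n} m x y =
  ∃[ gs ] (length gs ≡ m × Unique gs × All (IsGeodesic x y) gs
           × (∀ (p : List (V n)) → IsGeodesic x y p → p ∈ gs))

AllGeodesicsUseInner : ∀ {n} .{{_ : NonZero n}} → V n → V n → Set
AllGeodesicsUseInner {n} x y =
  ∀ (p : List (V n)) → IsGeodesic x y p → Any isInner p

module Submission where

-- Count the edges of a walk from u₀: a forward and b backward outer edges, c spokes, d forward and
-- e backward inner edges. It has a + b + c + d + e edges and ends at index a + 2d − b − 2e (mod n),
-- and if it enters the inner cycle it uses at least two spokes. For n = 2k + 1 and odd r = 2h + 1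
-- with 5 < r ≤ k, a walk to u_r of at most h + 3 edges either runs forwards, without wrapping, and
-- then (parity of r) a = 1, d = h, b = e = 0, c = 2; or it wraps backwards once, which forces
-- n = 2r + 1, i.e. k = r, and a = b = d = 0, e = h + 1, c = 2. The first counts are realised
-- exactly by u₀v₀v₂…v_{2h}u_{2h}u_r and u₀u₁v₁v₃…v_r u_r, the second exactly by
-- u₀v₀v_{−2}…v_r u_r. All have h + 3 edges, so they are the geodesics, and all pass through inner
-- vertices.

open import Defs
open import Data.Nat using (ℕ; zero; suc; _+_; _*_; _≤_; _<_; z≤n; s≤s; s≤s⁻¹; NonZero; _%_; _/_)
open import Data.Nat.Properties
open import Data.Nat.DivMod using (m≡m%n+[m/n]*n; m%n<n; _mod_; n%n≡0; %-distribˡ-+; m%n%n≡m%n; m<n⇒m%n≡m)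
open import Data.Nat.Divisibility using (_∣_; m%n≡0⇒n∣m)
open import Data.Nat.Tactic.RingSolver using (solve)
open import Data.Fin using (Fin; toℕ)
open import Data.Fin.Properties using (toℕ-fromℕ<; toℕ-injective; toℕ<n)
open import Data.List using (List; []; _∷_; _++_; length; last)
open import Data.Maybe using (just)
open import Level using (0ℓ)
open import Relation.Binary.Bundles using (Setoid)
import Relation.Binary.Reasoning.Setoid as SetoidReasoning
open import Algebra.Properties.CommutativeSemigroup +-commutativeSemigroup using (x∙yz≈y∙xz)
open import Data.List.Properties using (∷-injectiveˡ; ∷-injectiveʳ)
open import Data.Product using (_×_; _,_; proj₂; ∃-syntax)
open import Data.Sum using (_⊎_; inj₁; inj₂)
open import Relation.Binary.PropositionalEquality
open import Relation.Nullary using (¬_; contradiction)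

odd⇒≡1+2* : ∀ r → ¬ 2 ∣ r → ∃[ h ] r ≡ suc (2 * h)
odd⇒≡1+2* r 2∤r with r % 2 in r%2≡ | m%n<n r 2
... | 0           | _             = contradiction (m%n≡0⇒n∣m r 2 r%2≡) 2∤r
... | 1           | _             = r / 2 , (begin
  r                 ≡⟨ m≡m%n+[m/n]*n r 2 ⟩
  r % 2 + r / 2 * 2 ≡⟨ cong (_+ r / 2 * 2) r%2≡ ⟩
  suc (r / 2 * 2)   ≡⟨ cong suc (*-comm (r / 2) 2) ⟩
  suc (2 * (r / 2)) ∎)
  where open ≡-Reasoning
... | suc (suc _) | s≤s (s≤s ())

same-%⇒≡+* : ∀ {x y d} .{{_ : NonZero d}} t → x % d ≡ y % d → x / d + t ≡ y / d →
             y ≡ x + t * d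
same-%⇒≡+* {x} {y} {d} t %≡ /≡ = begin
  y                           ≡⟨ m≡m%n+[m/n]*n y d ⟩
  y % d + y / d * d           ≡⟨ cong₂ (λ s q → s + q * d) %≡ /≡ ⟨
  x % d + (x / d + t) * d     ≡⟨ cong (x % d +_) (*-distribʳ-+ d (x / d) t) ⟩
  x % d + (x / d * d + t * d) ≡⟨ +-assoc (x % d) _ _ ⟨
  x % d + x / d * d + t * d   ≡⟨ cong (_+ t * d) (m≡m%n+[m/n]*n x d) ⟨
  x + t * d                   ∎
  where open ≡-Reasoning

%-≡⇒offset : ∀ m n {d} .{{_ : NonZero d}} → m % d ≡ n % d →
             (∃[ t ] n ≡ m + t * d) ⊎ (∃[ t ] m ≡ n + suc t * d)
%-≡⇒offset m n {d} m%d≡n%d with ≤-<-connex (m / d) (n / d)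
... | inj₁ m/d≤n/d = let t , m/d+t≡n/d = m≤n⇒∃[o]m+o≡n m/d≤n/d in
  inj₁ (t , same-%⇒≡+* t m%d≡n%d m/d+t≡n/d)
... | inj₂ n/d<m/d = let t , 1+n/d+t≡m/d = m≤n⇒∃[o]m+o≡n n/d<m/d in
  inj₂ (t , same-%⇒≡+* (suc t) (sym m%d≡n%d) (trans (+-suc (n / d) t) 1+n/d+t≡m/d))

double-budget : ∀ h a b d e → a + b + d + e ≤ suc h →
                (a + 2 * d) + (b + 2 * e) + (a + b) ≤ suc (2 * h) + 1
double-budget h a b d e S≤ = begin
  (a + 2 * d) + (b + 2 * e) + (a + b) ≡⟨ solve (a ∷ b ∷ d ∷ e ∷ []) ⟩
  (a + b + d + e) + (a + b + d + e)   ≤⟨ +-mono-≤ S≤ S≤ ⟩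
  suc h + suc h                       ≡⟨ solve (h ∷ []) ⟩
  suc (2 * h) + 1                     ∎
  where open ≤-Reasoning

2*n≤1⇒n≡0 : ∀ n → 2 * n ≤ 1 → n ≡ 0
2*n≤1⇒n≡0 zero    _          = refl
2*n≤1⇒n≡0 (suc n) (s≤s 2n≤0) = contradiction (n≤0⇒n≡0 2n≤0) (m+1+n≢0 n)

forward-excess : ∀ h {N} t a b d e → a + 2 * d ≡ suc (2 * h) + (b + 2 * e) + t * N →
                 a + b + d + e ≤ suc h → 2 * (b + 2 * e) + t * N + (a + b) ≤ 1
forward-excess h {N} t a b d e D≡ S≤ = +-cancelˡ-≤ (suc (2 * h)) _ _ (begin
  suc (2 * h) + (2 * (b + 2 * e) + t * N + (a + b))         ≡⟨ solve (h ∷ b ∷ e ∷ t ∷ N ∷ a ∷ []) ⟩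
  suc (2 * h) + (b + 2 * e) + t * N + (b + 2 * e) + (a + b) ≡⟨ cong (λ D → D + (b + 2 * e) + (a + b)) D≡ ⟨
  a + 2 * d + (b + 2 * e) + (a + b)                         ≤⟨ double-budget h a b d e S≤ ⟩
  suc (2 * h) + 1                                           ∎)
  where open ≤-Reasoning

no-backward-steps : ∀ h {N} t a b d e → a + 2 * d ≡ suc (2 * h) + (b + 2 * e) + t * N →
                    a + b + d + e ≤ suc h → b + 2 * e ≡ 0
no-backward-steps h t a b d e D≡ S≤ =
  2*n≤1⇒n≡0 _ (m+n≤o⇒m≤o _ (m+n≤o⇒m≤o _ (forward-excess h t a b d e D≡ S≤)))

forward-counts : ∀ h {N} t a b d e → 2 ≤ N → a + 2 * d ≡ suc (2 * h) + (b + 2 * e) + t * N →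
                 a + b + d + e ≤ suc h → a ≡ 1 × b ≡ 0 × d ≡ h × e ≡ 0
forward-counts h t a (suc b) d e _ D≡ S≤ =
  contradiction (no-backward-steps h t a (suc b) d e D≡ S≤) λ ()
forward-counts h t a zero d (suc e) _ D≡ S≤ =
  contradiction (no-backward-steps h t a zero d (suc e) D≡ S≤) λ ()
forward-counts h {N} (suc t) a zero d zero 2≤N D≡ S≤ =
  contradiction (≤-trans 2≤N (m+n≤o⇒m≤o N (m+n≤o⇒m≤o (N + t * N) (forward-excess h (suc t) a 0 d 0 D≡ S≤))))
                λ { (s≤s ()) }
forward-counts h zero 0 zero d zero _ D≡ _ =
  contradiction (trans D≡ (trans (+-identityʳ _) (+-identityʳ _))) (even≢odd d h)
forward-counts h zero 1 zero d zero _ D≡ _ =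
  refl , refl , *-cancelˡ-≡ d h 2 (suc-injective (trans D≡ (trans (+-identityʳ _) (+-identityʳ _)))) , refl
forward-counts h {N} zero (suc (suc a)) zero d zero _ D≡ S≤ with forward-excess h {N} 0 (suc (suc a)) 0 d 0 D≡ S≤
... | s≤s ()

backward-overshoot : ∀ h {N} t a b d e → suc (2 * h) + (b + 2 * e) ≡ a + 2 * d + suc t * N →
                     a + b + d + e ≤ suc h →
                     N + (2 * (a + 2 * d) + t * N + (a + b)) ≤ suc (2 * suc (2 * h))
backward-overshoot h {N} t a b d e B≡ S≤ = begin
  N + (2 * (a + 2 * d) + t * N + (a + b))             ≡⟨ solve (N ∷ a ∷ d ∷ t ∷ b ∷ []) ⟩
  a + 2 * d + (a + 2 * d + suc t * N) + (a + b)       ≡⟨ cong (λ X → a + 2 * d + X + (a + b)) B≡ ⟨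
  a + 2 * d + (suc (2 * h) + (b + 2 * e)) + (a + b)   ≡⟨ solve (a ∷ d ∷ h ∷ b ∷ e ∷ []) ⟩
  suc (2 * h) + ((a + 2 * d) + (b + 2 * e) + (a + b)) ≤⟨ +-monoʳ-≤ (suc (2 * h)) (double-budget h a b d e S≤) ⟩
  suc (2 * h) + (suc (2 * h) + 1)                     ≡⟨ solve (h ∷ []) ⟩
  suc (2 * suc (2 * h))                               ∎
  where open ≤-Reasoning

backward-zero : ∀ h {N} t a b d e → N ≡ suc (2 * suc (2 * h)) →
                2 * (a + 2 * d) + t * N + (a + b) ≡ 0 →
                suc (2 * h) + (b + 2 * e) ≡ a + 2 * d + suc t * N →
                a ≡ 0 × b ≡ 0 × d ≡ 0 × e ≡ suc h
backward-zero h t       (suc a) b       d       e refl () _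
backward-zero h t       zero    b       (suc d) e refl () _
backward-zero h (suc t) zero    b       zero    e refl () _
backward-zero h zero    zero    (suc b) zero    e refl () _
backward-zero h zero    zero    zero    zero    e refl _ B≡ =
  refl , refl , refl , *-cancelˡ-≡ e (suc h) 2 (+-cancelˡ-≡ (suc (2 * h)) _ _ (begin
    suc (2 * h) + 2 * e         ≡⟨ B≡ ⟩
    suc (2 * suc (2 * h)) + 0   ≡⟨ solve (h ∷ []) ⟩
    suc (2 * h) + 2 * suc h     ∎))
  where open ≡-Reasoning

backward-counts : ∀ h {N} t a b d e → suc (2 * suc (2 * h)) ≤ N →
                  suc (2 * h) + (b + 2 * e) ≡ a + 2 * d + suc t * N → a + b + d + e ≤ suc h →
                  N ≡ suc (2 * suc (2 * h)) × a ≡ 0 × b ≡ 0 × d ≡ 0 × e ≡ suc h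
backward-counts h {N} t a b d e 2r<N B≡ S≤ = N≡ , backward-zero h t a b d e N≡ excess≡0 B≡
  where
  overshoot : N + (2 * (a + 2 * d) + t * N + (a + b)) ≤ suc (2 * suc (2 * h))
  overshoot = backward-overshoot h t a b d e B≡ S≤
  N≡ : N ≡ suc (2 * suc (2 * h))
  N≡ = ≤-antisym (m+n≤o⇒m≤o N overshoot) 2r<N
  excess≡0 : 2 * (a + 2 * d) + t * N + (a + b) ≡ 0
  excess≡0 = n≤0⇒n≡0 (+-cancelˡ-≤ N _ 0 (begin
    N + (2 * (a + 2 * d) + t * N + (a + b)) ≤⟨ overshoot ⟩
    suc (2 * suc (2 * h))                   ≤⟨ 2r<N ⟩
    N                                       ≡⟨ +-identityʳ N ⟨
    N + 0                                   ∎))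
    where open ≤-Reasoning

displacement-lower-bound : ∀ r {N} D B → suc (2 * r) ≤ N →
  (∃[ t ] D ≡ r + B + t * N) ⊎ (∃[ t ] r + B ≡ D + suc t * N) → r ≤ D + B
displacement-lower-bound r {N} D B _ (inj₁ (t , D≡)) = begin
  r             ≤⟨ m≤m+n r B ⟩
  r + B         ≤⟨ m≤m+n (r + B) (t * N) ⟩
  r + B + t * N ≡⟨ D≡ ⟨
  D             ≤⟨ m≤m+n D B ⟩
  D + B         ∎
  where open ≤-Reasoning
displacement-lower-bound r {N} D B 2r<N (inj₂ (t , B≡)) =
  ≤-trans (+-cancelˡ-≤ r r B (begin
    r + r         ≡⟨ solve (r ∷ []) ⟩
    2 * r         ≤⟨ n≤1+n (2 * r) ⟩
    suc (2 * r)   ≤⟨ 2r<N ⟩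
    N             ≤⟨ m≤m+n N (t * N) ⟩
    suc t * N     ≤⟨ m≤n+m (suc t * N) D ⟩
    D + suc t * N ≡⟨ B≡ ⟨
    r + B         ∎))
    (m≤n+m B D)
  where open ≤-Reasoning

3+h<1+2h : ∀ {h} → 3 ≤ h → 3 + h < suc (2 * h)
3+h<1+2h {h} 3≤h = s≤s (begin
  3 + h ≤⟨ +-monoˡ-≤ h 3≤h ⟩
  h + h ≡⟨ solve (h ∷ []) ⟩
  2 * h ∎)
  where open ≤-Reasoning

spoke-budget : ∀ h a b c d e → a + b + c + d + e ≤ 3 + h → 2 ≤ c → a + b + d + e ≤ suc h
spoke-budget h a b c d e T≤ 2≤c = +-cancelʳ-≤ 2 _ _ (begin
  a + b + d + e + 2 ≤⟨ +-monoʳ-≤ (a + b + d + e) 2≤c ⟩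
  a + b + d + e + c ≡⟨ solve (a ∷ b ∷ c ∷ d ∷ e ∷ []) ⟩
  a + b + c + d + e ≤⟨ T≤ ⟩
  3 + h             ≡⟨ solve (h ∷ []) ⟩
  suc h + 2         ∎)
  where open ≤-Reasoning

exactly-two-spokes : ∀ h a b c d e → a + b + c + d + e ≤ 3 + h → a + b + d + e ≡ suc h →
                     2 ≤ c → c ≡ 2
exactly-two-spokes h a b c d e T≤ S≡ 2≤c = ≤-antisym (+-cancelˡ-≤ (suc h) c 2 (begin
  suc h + c         ≡⟨ cong (_+ c) S≡ ⟨
  a + b + d + e + c ≡⟨ solve (a ∷ b ∷ c ∷ d ∷ e ∷ []) ⟩
  a + b + c + d + e ≤⟨ T≤ ⟩
  3 + h             ≡⟨ solve (h ∷ []) ⟩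
  suc h + 2         ∎)) 2≤c
  where open ≤-Reasoning

1+2h+2[1+h]≡1+2[1+2h] : ∀ h → suc (2 * h) + 2 * suc h ≡ suc (2 * suc (2 * h))
1+2h+2[1+h]≡1+2[1+2h] h = solve (h ∷ [])

module _ (k h : ℕ) (3≤h : 3 ≤ h) (r≤k : suc (2 * h) ≤ k) where

  private
    r N : ℕ
    r = suc (2 * h)
    N = suc (2 * k)

    2r<N : suc (2 * r) ≤ N
    2r<N = s≤s (*-monoʳ-≤ 2 r≤k)

  inner-walk-counts : ∀ a b c d e → a + b + c + d + e ≤ 3 + h → 2 ≤ c →
    (r + (b + 2 * e)) % N ≡ (a + 2 * d) % N →
    (a ≡ 1 × b ≡ 0 × c ≡ 2 × d ≡ h × e ≡ 0) ⊎ (k ≡ r × a ≡ 0 × b ≡ 0 × c ≡ 2 × d ≡ 0 × e ≡ suc h)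
  inner-walk-counts a b c d e T≤ 2≤c ≡%
    with spoke-budget h a b c d e T≤ 2≤c | %-≡⇒offset (r + (b + 2 * e)) (a + 2 * d) ≡%
  ... | S≤ | inj₁ (t , D≡) with forward-counts h t a b d e (≤-trans (s≤s (s≤s z≤n)) 2r<N) D≡ S≤
  ...   | refl , refl , refl , refl =
    inj₁ (refl , refl , exactly-two-spokes h 1 0 c h 0 T≤ (cong suc (+-identityʳ h)) 2≤c , refl , refl)
  inner-walk-counts a b c d e T≤ 2≤c ≡% | S≤ | inj₂ (t , B≡) with backward-counts h t a b d e 2r<N B≡ S≤
  ...   | N≡ , refl , refl , refl , refl =
    inj₂ (*-cancelˡ-≡ k r 2 (suc-injective N≡) , refl , refl ,
          exactly-two-spokes h 0 0 c 0 (suc h) T≤ refl 2≤c , refl , refl)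

  short-walk-counts : ∀ a b c d e → a + b + c + d + e ≤ 3 + h → (0 < d + e → 2 ≤ c) →
    (r + (b + 2 * e)) % N ≡ (a + 2 * d) % N →
    (a ≡ 1 × b ≡ 0 × c ≡ 2 × d ≡ h × e ≡ 0) ⊎ (k ≡ r × a ≡ 0 × b ≡ 0 × c ≡ 2 × d ≡ 0 × e ≡ suc h)
  short-walk-counts a b c zero zero T≤ _ ≡% = contradiction (begin
    r                 ≤⟨ displacement-lower-bound r (a + 0) (b + 0) 2r<N (%-≡⇒offset (r + (b + 0)) (a + 0) ≡%) ⟩
    a + 0 + (b + 0)   ≡⟨ solve (a ∷ b ∷ []) ⟩
    a + b + 0         ≤⟨ +-monoʳ-≤ (a + b) z≤n ⟩
    a + b + c         ≡⟨ solve (a ∷ b ∷ c ∷ []) ⟩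
    a + b + c + 0 + 0 ≤⟨ T≤ ⟩
    3 + h             ∎) (<⇒≱ (3+h<1+2h 3≤h))
    where open ≤-Reasoning
  short-walk-counts a b c (suc d) e T≤ spokes ≡% = inner-walk-counts a b c (suc d) e T≤ (spokes (s≤s z≤n)) ≡%
  short-walk-counts a b c zero (suc e) T≤ spokes ≡% = inner-walk-counts a b c zero (suc e) T≤ (spokes (s≤s z≤n)) ≡%

module Walks (N : ℕ) .{{_ : NonZero N}} where

  open import Data.List.Relation.Unary.Linked using (Linked; [-]; _∷_)
  open import Data.List.Relation.Unary.All as All using (All)
  open import Data.List.Relation.Unary.Any using (Any)
  open import Data.List.Relation.Unary.Unique.Propositional using (Unique)
  open import Data.List.Membership.Propositional using (_∈_)

  -- A record rather than a synonym for m % N ≡ n % N: _%_ on a concrete N unfolds, which would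
  -- leave m and n uninferable from a proof of m ≋ n.
  infix 4 _≋_
  record _≋_ (m n : ℕ) : Set where
    constructor mod-≡
    field ≡-mod : m % N ≡ n % N

  ≋-setoid : Setoid 0ℓ 0ℓ
  ≋-setoid = record
    { _≈_           = _≋_
    ; isEquivalence = record
      { refl  = mod-≡ refl
      ; sym   = λ (mod-≡ p) → mod-≡ (sym p)
      ; trans = λ (mod-≡ p) (mod-≡ q) → mod-≡ (trans p q)
      }
    }

  open Setoid ≋-setoid public using () renaming (refl to ≋-refl; sym to ≋-sym; trans to ≋-trans)

  ≡⇒≋ : ∀ {m n} → m ≡ n → m ≋ n
  ≡⇒≋ m≡n = mod-≡ (cong (_% N) m≡n)

  ≋-+ : ∀ {m n m′ n′} → m ≋ n → m′ ≋ n′ → m + m′ ≋ n + n′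
  ≋-+ {m} {n} {m′} {n′} (mod-≡ m≋n) (mod-≡ m′≋n′) = mod-≡ (begin
    (m + m′) % N             ≡⟨ %-distribˡ-+ m m′ N ⟩
    (m % N + m′ % N) % N     ≡⟨ cong₂ (λ x y → (x + y) % N) m≋n m′≋n′ ⟩
    (n % N + n′ % N) % N     ≡⟨ %-distribˡ-+ n n′ N ⟨
    (n + n′) % N             ∎)
    where open ≡-Reasoning

  toℕ-mod : ∀ m → toℕ (m mod N) ≋ m
  toℕ-mod m = mod-≡ (trans (cong (_% N) (toℕ-fromℕ< _)) (m%n%n≡m%n m N))

  toℕ-⊕ : ∀ i s → toℕ (i ⊕ s) ≋ toℕ i + s
  toℕ-⊕ i s = toℕ-mod (toℕ i + s)

  ≋⇒≡mod : ∀ {i m} → toℕ i ≋ m → i ≡ m mod N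
  ≋⇒≡mod {i} {m} (mod-≡ i≋m) = toℕ-injective (begin
    toℕ i         ≡⟨ m<n⇒m%n≡m (toℕ<n i) ⟨
    toℕ i % N     ≡⟨ i≋m ⟩
    m % N         ≡⟨ toℕ-fromℕ< _ ⟨
    toℕ (m mod N) ∎)
    where open ≡-Reasoning

  ≋-<⇒≡ : ∀ {m n} → m < N → n < N → m ≋ n → m ≡ n
  ≋-<⇒≡ m<N n<N (mod-≡ m≋n) = trans (sym (m<n⇒m%n≡m m<N)) (trans m≋n (m<n⇒m%n≡m n<N))

  ⊕-shift : ∀ i s m → toℕ i + (s + m) ≋ toℕ (i ⊕ s) + m
  ⊕-shift i s m = begin
    toℕ i + (s + m)   ≡⟨ +-assoc (toℕ i) s m ⟨
    toℕ i + s + m     ≈⟨ ≋-+ (≋-sym (toℕ-⊕ i s)) ≋-refl ⟩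
    toℕ (i ⊕ s) + m   ∎
    where open SetoidReasoning ≋-setoid

  ⊕-unshift : ∀ i s {m n o} → toℕ i + m ≋ n + o → toℕ (i ⊕ s) + m ≋ n + (s + o)
  ⊕-unshift i s {m} {n} {o} i+m≋n+o = begin
    toℕ (i ⊕ s) + m   ≈⟨ ⊕-shift i s m ⟨
    toℕ i + (s + m)   ≡⟨ x∙yz≈y∙xz (toℕ i) s m ⟩
    s + (toℕ i + m)   ≈⟨ ≋-+ (≋-refl {s}) i+m≋n+o ⟩
    s + (n + o)       ≡⟨ x∙yz≈y∙xz s n o ⟩
    n + (s + o)       ∎
    where open SetoidReasoning ≋-setoid

  _↑_ : Fin N → ℕ → Fin N
  j ↑ zero  = j
  j ↑ suc c = (j ⊕ 2) ↑ c

  ↑-suc : ∀ j c → j ↑ suc c ≡ (j ↑ c) ⊕ 2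
  ↑-suc j zero    = refl
  ↑-suc j (suc c) = ↑-suc (j ⊕ 2) c

  toℕ-↑ : ∀ j c → toℕ (j ↑ c) ≋ toℕ j + 2 * c
  toℕ-↑ j zero    = ≡⇒≋ (sym (+-identityʳ (toℕ j)))
  toℕ-↑ j (suc c) = begin
    toℕ ((j ⊕ 2) ↑ c)      ≈⟨ toℕ-↑ (j ⊕ 2) c ⟩
    toℕ (j ⊕ 2) + 2 * c    ≈⟨ ≋-+ (toℕ-⊕ j 2) ≋-refl ⟩
    toℕ j + 2 + 2 * c      ≡⟨ +-assoc (toℕ j) 2 (2 * c) ⟩
    toℕ j + (2 + 2 * c)    ≡⟨ cong (toℕ j +_) (*-suc 2 c) ⟨
    toℕ j + 2 * suc c      ∎
    where open SetoidReasoning ≋-setoid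

  index : V N → Fin N
  index (u i) = i
  index (v i) = i

  private variable
    i j l : Fin N
    x y z : V N
    ps : List (V N)
    a b c d e : ℕ

  -- A walk with vertex list x ∷ ps, indexed by its numbers of forward outer edges (a), backward
  -- outer edges (b), spokes (c), forward inner edges (d) and backward inner edges (e).
  data CountedWalk : V N → V N → List (V N) → ℕ → ℕ → ℕ → ℕ → ℕ → Set where
    stay   : CountedWalk x x [] 0 0 0 0 0
    out+   : ∀ i → CountedWalk (u (i ⊕ 1)) z ps a b c d e →
             CountedWalk (u i) z (u (i ⊕ 1) ∷ ps) (suc a) b c d e
    out-   : ∀ i → CountedWalk (u i) z ps a b c d e →
             CountedWalk (u (i ⊕ 1)) z (u i ∷ ps) a (suc b) c d e
    spoke+ : ∀ i → CountedWalk (v i) z ps a b c d e →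
             CountedWalk (u i) z (v i ∷ ps) a b (suc c) d e
    spoke- : ∀ i → CountedWalk (u i) z ps a b c d e →
             CountedWalk (v i) z (u i ∷ ps) a b (suc c) d e
    in+    : ∀ i → CountedWalk (v (i ⊕ 2)) z ps a b c d e →
             CountedWalk (v i) z (v (i ⊕ 2) ∷ ps) a b c (suc d) e
    in-    : ∀ i → CountedWalk (v i) z ps a b c d e →
             CountedWalk (v (i ⊕ 2)) z (v i ∷ ps) a b c d (suc e)

  data Counted (x z : V N) (ps : List (V N)) : Set where
    counted : CountedWalk x z ps a b c d e → Counted x z ps

  prepend : Adj x y → Counted y z ps → Counted x z (y ∷ ps)
  prepend (outer→ i) (counted w) = counted (out+ i w)
  prepend (outer← i) (counted w) = counted (out- i w)
  prepend (spoke→ i) (counted w) = counted (spoke+ i w)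
  prepend (spoke← i) (counted w) = counted (spoke- i w)
  prepend (inner→ i) (counted w) = counted (in+ i w)
  prepend (inner← i) (counted w) = counted (in- i w)

  count : Linked Adj (x ∷ ps) → last (x ∷ ps) ≡ just z → Counted x z ps
  count {ps = []}    [-]         refl = counted stay
  count {ps = _ ∷ _} (adj ∷ adjs) end = prepend adj (count adjs end)

  linked : CountedWalk x z ps a b c d e → Linked Adj (x ∷ ps)
  linked stay         = [-]
  linked (out+ i w)   = outer→ i ∷ linked w
  linked (out- i w)   = outer← i ∷ linked w
  linked (spoke+ i w) = spoke→ i ∷ linked w
  linked (spoke- i w) = spoke← i ∷ linked w
  linked (in+ i w)    = inner→ i ∷ linked w
  linked (in- i w)    = inner← i ∷ linked w

  ends : CountedWalk x z ps a b c d e → last (x ∷ ps) ≡ just z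
  ends stay         = refl
  ends (out+ _ w)   = ends w
  ends (out- _ w)   = ends w
  ends (spoke+ _ w) = ends w
  ends (spoke- _ w) = ends w
  ends (in+ _ w)    = ends w
  ends (in- _ w)    = ends w

  isWalk : CountedWalk x z ps a b c d e → IsWalk x z (x ∷ ps)
  isWalk w = linked w , refl , ends w

  edges : CountedWalk x z ps a b c d e → length ps ≡ a + b + c + d + e
  edges stay         = refl
  edges (out+ _ w)   = cong suc (edges w)
  edges {a = a} {b = suc b} {c} {d} {e} (out- _ w) =
    trans (cong suc (edges w)) (cong (λ s → s + c + d + e) (sym (+-suc a b)))
  edges {a = a} {b} {suc c} {d} {e} (spoke+ _ w) =
    trans (cong suc (edges w)) (cong (λ s → s + d + e) (sym (+-suc (a + b) c)))
  edges {a = a} {b} {suc c} {d} {e} (spoke- _ w) =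
    trans (cong suc (edges w)) (cong (λ s → s + d + e) (sym (+-suc (a + b) c)))
  edges {a = a} {b} {c} {suc d} {e} (in+ _ w) =
    trans (cong suc (edges w)) (cong (_+ e) (sym (+-suc (a + b + c) d)))
  edges {a = a} {b} {c} {d} {suc e} (in- _ w) =
    trans (cong suc (edges w)) (sym (+-suc (a + b + c + d) e))

  +2*suc : ∀ m n → m + 2 * suc n ≡ 2 + (m + 2 * n)
  +2*suc m n = trans (cong (m +_) (*-suc 2 n)) (x∙yz≈y∙xz m 2 (2 * n))

  displacement : CountedWalk x z ps a b c d e →
                 toℕ (index x) + (a + 2 * d) ≋ toℕ (index z) + (b + 2 * e)
  displacement stay         = ≋-refl
  displacement (out+ i w)   = ≋-trans (⊕-shift i 1 _) (displacement w)
  displacement (out- i w)   = ⊕-unshift i 1 (displacement w)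
  displacement (spoke+ i w) = displacement w
  displacement (spoke- i w) = displacement w
  displacement {a = a} {d = suc d} (in+ i w) =
    ≋-trans (≡⇒≋ (cong (toℕ i +_) (+2*suc a d))) (≋-trans (⊕-shift i 2 _) (displacement w))
  displacement {z = z} {b = b} {e = suc e} (in- i w) =
    ≋-trans (⊕-unshift i 2 (displacement w)) (≡⇒≋ (cong (toℕ (index z) +_) (sym (+2*suc b e))))

  inner→outer⇒spoke : CountedWalk (v j) (u l) ps a b c d e → 1 ≤ c
  inner→outer⇒spoke (spoke- _ _) = s≤s z≤n
  inner→outer⇒spoke (in+ _ w)    = inner→outer⇒spoke w
  inner→outer⇒spoke (in- _ w)    = inner→outer⇒spoke w

  inner-edge⇒two-spokes : CountedWalk (u j) (u l) ps a b c d e → 0 < d + e → 2 ≤ c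
  inner-edge⇒two-spokes stay         ()
  inner-edge⇒two-spokes (out+ _ w)   = inner-edge⇒two-spokes w
  inner-edge⇒two-spokes (out- _ w)   = inner-edge⇒two-spokes w
  inner-edge⇒two-spokes (spoke+ _ w) = λ _ → s≤s (inner→outer⇒spoke w)

  climb : Fin N → ℕ → List (V N)
  climb j zero    = u j ∷ []
  climb j (suc c) = v (j ⊕ 2) ∷ climb (j ⊕ 2) c

  descend : Fin N → ℕ → List (V N)
  descend l zero    = u l ∷ []
  descend l (suc c) = v (l ↑ c) ∷ descend l c

  climb-shape : CountedWalk (v j) z ps 0 0 1 c 0 → ps ≡ climb j c
  climb-shape (spoke- _ stay) = refl
  climb-shape (in+ i w)       = cong (v (i ⊕ 2) ∷_) (climb-shape w)

  climb-step-shape : CountedWalk (v j) z ps 1 0 1 c 0 → ps ≡ climb j c ++ u ((j ↑ c) ⊕ 1) ∷ []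
  climb-step-shape (spoke- _ (out+ _ stay)) = refl
  climb-step-shape (in+ i w)                = cong (v (i ⊕ 2) ∷_) (climb-step-shape w)

  descend-shape : CountedWalk (v j) (u l) ps 0 0 1 0 c → j ≡ l ↑ c × ps ≡ descend l c
  descend-shape (spoke- _ stay) = refl , refl
  descend-shape {l = l} {c = suc c} (in- _ w) with descend-shape w
  ... | refl , refl = sym (↑-suc l c) , refl

  climbing-route-shape : CountedWalk (u i) z ps 1 0 2 c 0 →
                         ps ≡ v i ∷ climb i c ++ u ((i ↑ c) ⊕ 1) ∷ []
                         ⊎ ps ≡ u (i ⊕ 1) ∷ v (i ⊕ 1) ∷ climb (i ⊕ 1) c
  climbing-route-shape (spoke+ i w)          = inj₁ (cong (v i ∷_) (climb-step-shape w))
  climbing-route-shape (out+ i (spoke+ _ w)) = inj₂ (cong (λ q → u (i ⊕ 1) ∷ v (i ⊕ 1) ∷ q) (climb-shape w))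

  descending-route-shape : CountedWalk (u i) (u l) ps 0 0 2 0 c → ps ≡ v i ∷ descend l c
  descending-route-shape (spoke+ i w) = cong (v i ∷_) (proj₂ (descend-shape w))

  climbing : ∀ j c → CountedWalk (v j) (u (j ↑ c)) (climb j c) 0 0 1 c 0
  climbing j zero    = spoke- j stay
  climbing j (suc c) = in+ j (climbing (j ⊕ 2) c)

  climbing-step : ∀ j c → CountedWalk (v j) (u ((j ↑ c) ⊕ 1)) (climb j c ++ u ((j ↑ c) ⊕ 1) ∷ []) 1 0 1 c 0
  climbing-step j zero    = spoke- j (out+ j stay)
  climbing-step j (suc c) = in+ j (climbing-step (j ⊕ 2) c)

  descending : ∀ l c → CountedWalk (v (l ↑ c)) (u l) (descend l c) 0 0 1 0 c
  descending l zero    = spoke- l stay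
  descending l (suc c) = subst (λ j → CountedWalk (v j) (u l) (descend l (suc c)) 0 0 1 0 (suc c))
                               (sym (↑-suc l c)) (in- (l ↑ c) (descending l c))

  module Enumeration {x y : V N} {ℓ : ℕ} (g : List (V N)) (gs : List (List (V N)))
    (candidates : All (λ p → IsWalk x y p × length p ≡ ℓ) (g ∷ gs))
    (complete : ∀ q → IsWalk x y q → length q ≤ ℓ → q ∈ g ∷ gs) where

    shortest : ∀ q → IsWalk x y q → ℓ ≤ length q
    shortest q walk with ≤-total ℓ (length q)
    ... | inj₁ ℓ≤ = ℓ≤
    ... | inj₂ ≤ℓ = ≤-reflexive (sym (proj₂ (All.lookup candidates (complete q walk ≤ℓ))))

    geodesic⇒candidate : ∀ p → IsGeodesic x y p → p ∈ g ∷ gs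
    geodesic⇒candidate p (walk , minimal) =
      let g-walk , g-length = All.head candidates in
      complete p walk (subst (length p ≤_) g-length (minimal g g-walk))

    exactly-geodesics : Unique (g ∷ gs) → ExactlyGeodesics (length (g ∷ gs)) x y
    exactly-geodesics unique = g ∷ gs , refl , unique ,
      All.map (λ { (walk , refl) → walk , shortest }) candidates , geodesic⇒candidate

    geodesics-use-inner : All (Any isInner) (g ∷ gs) → AllGeodesicsUseInner x y
    geodesics-use-inner inner p geodesic = All.lookup inner (geodesic⇒candidate p geodesic)

module Geodesics (k h : ℕ) (3≤h : 3 ≤ h) (r≤k : suc (2 * h) ≤ k) where

  open import Data.Fin using (zero)
  open import Data.List.Relation.Unary.All using (All; []; _∷_)
  open import Data.List.Relation.Unary.AllPairs using ([]; _∷_)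
  open import Data.List.Relation.Unary.Any using (Any; here; there)
  open import Data.List.Membership.Propositional using (_∈_)

  r N : ℕ
  r = suc (2 * h)
  N = suc (2 * k)

  open Walks N

  target : Fin N
  target = r mod N

  routeA routeB routeC : List (V N)
  routeA = v zero ∷ climb zero h ++ u ((zero ↑ h) ⊕ 1) ∷ []
  routeB = u (zero ⊕ 1) ∷ v (zero ⊕ 1) ∷ climb (zero ⊕ 1) h
  routeC = v zero ∷ descend target (suc h)

  geodesicA geodesicB geodesicC : List (V N)
  geodesicA = u zero ∷ routeA
  geodesicB = u zero ∷ routeB
  geodesicC = u zero ∷ routeC

  short-walks : ∀ q → IsWalk (u zero) (u target) q → length q ≤ 4 + h →
                q ≡ geodesicA ⊎ q ≡ geodesicB ⊎ (k ≡ r × q ≡ geodesicC)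
  short-walks (_ ∷ ps) (adjs , refl , end) length≤ with count adjs end
  ... | counted {a = a} {b} {c} {d} {e} w
    with short-walk-counts k h 3≤h r≤k a b c d e
           (subst (_≤ 3 + h) (edges w) (s≤s⁻¹ length≤)) (inner-edge⇒two-spokes w) (_≋_.≡-mod offset)
    where
    offset : r + (b + 2 * e) ≋ a + 2 * d
    offset = begin
      r + (b + 2 * e)            ≈⟨ ≋-+ (toℕ-mod r) ≋-refl ⟨
      toℕ target + (b + 2 * e)   ≈⟨ displacement w ⟨
      a + 2 * d                  ∎
      where open SetoidReasoning ≋-setoid
  ... | inj₁ (refl , refl , refl , refl , refl) with climbing-route-shape w
  ...   | inj₁ ps≡ = inj₁ (cong (u zero ∷_) ps≡)
  ...   | inj₂ ps≡ = inj₂ (inj₁ (cong (u zero ∷_) ps≡))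
  short-walks (_ ∷ ps) (adjs , refl , end) length≤ | counted w | inj₂ (k≡r , refl , refl , refl , refl , refl) =
    inj₂ (inj₂ (k≡r , cong (u zero ∷_) (descending-route-shape w)))

  routeA-ends : (zero ↑ h) ⊕ 1 ≡ target
  routeA-ends = ≋⇒≡mod (begin
    toℕ ((zero ↑ h) ⊕ 1) ≈⟨ toℕ-⊕ (zero ↑ h) 1 ⟩
    toℕ (zero ↑ h) + 1   ≈⟨ ≋-+ (toℕ-↑ zero h) (≋-refl {1}) ⟩
    2 * h + 1            ≡⟨ +-comm (2 * h) 1 ⟩
    r                    ∎)
    where open SetoidReasoning ≋-setoid

  routeB-ends : (zero ⊕ 1) ↑ h ≡ target
  routeB-ends = ≋⇒≡mod (≋-trans (toℕ-↑ (zero ⊕ 1) h) (≋-+ (toℕ-⊕ zero 1) (≋-refl {2 * h})))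

  routeC-starts : k ≡ r → target ↑ suc h ≡ zero
  routeC-starts refl = ≋⇒≡mod (begin
    toℕ (target ↑ suc h)       ≈⟨ toℕ-↑ target (suc h) ⟩
    toℕ target + 2 * suc h     ≈⟨ ≋-+ (toℕ-mod r) (≋-refl {2 * suc h}) ⟩
    r + 2 * suc h              ≡⟨ 1+2h+2[1+h]≡1+2[1+2h] h ⟩
    N                          ≈⟨ mod-≡ (n%n≡0 N) ⟩
    0                          ∎)
    where open SetoidReasoning ≋-setoid

  walkA : CountedWalk (u zero) (u target) routeA 1 0 2 h 0
  walkA = spoke+ zero (subst (λ l → CountedWalk (v zero) (u l) (climb zero h ++ u ((zero ↑ h) ⊕ 1) ∷ []) 1 0 1 h 0)
                             routeA-ends (climbing-step zero h))

  walkB : CountedWalk (u zero) (u target) routeB 1 0 2 h 0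
  walkB = out+ zero (spoke+ (zero ⊕ 1) (subst (λ l → CountedWalk (v (zero ⊕ 1)) (u l) (climb (zero ⊕ 1) h) 0 0 1 h 0)
                                              routeB-ends (climbing (zero ⊕ 1) h)))

  walkC : k ≡ r → CountedWalk (u zero) (u target) routeC 0 0 2 0 (suc h)
  walkC k≡r = spoke+ zero (subst (λ j → CountedWalk (v j) (u target) (descend target (suc h)) 0 0 1 0 (suc h))
                                 (routeC-starts k≡r) (descending target (suc h)))

  A≢B : geodesicA ≢ geodesicB
  A≢B ()

  B≢C : geodesicB ≢ geodesicC
  B≢C ()

  A≢C : k ≡ r → geodesicA ≢ geodesicC
  -- Writing h = 3 + o unfolds both lists far enough to compare their third vertices, v₂ and v_{−2}.
  A≢C refl A≡C with m≤n⇒∃[o]m+o≡n 3≤h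
  ... | _ , refl = <⇒≢ 2<r+2h (≋-<⇒≡ (≤-trans 2<r+2h (<⇒≤ r+2h<N)) r+2h<N third-positions)
    where
    third-indices : zero ⊕ 2 ≡ target ↑ h
    third-indices = cong index (∷-injectiveˡ (∷-injectiveʳ (∷-injectiveʳ A≡C)))
    third-positions : 2 ≋ r + 2 * h
    third-positions = begin
      2                  ≈⟨ ≋-trans (≋-sym (toℕ-⊕ zero 2)) (≡⇒≋ (cong toℕ third-indices)) ⟩
      toℕ (target ↑ h)   ≈⟨ toℕ-↑ target h ⟩
      toℕ target + 2 * h ≈⟨ ≋-+ (toℕ-mod r) (≋-refl {2 * h}) ⟩
      r + 2 * h          ∎
      where open SetoidReasoning ≋-setoid
    2<r+2h : 2 < r + 2 * h
    2<r+2h = ≤-trans 3≤h (≤-trans (≤-trans (m≤m+n h (h + 0)) (n≤1+n (2 * h))) (m≤m+n r (2 * h)))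
    r+2h<N : r + 2 * h < N
    r+2h<N = s≤s (+-monoʳ-≤ r (≤-trans (n≤1+n (2 * h)) (≤-reflexive (sym (+-identityʳ r)))))

  Candidate : List (V N) → Set
  Candidate p = IsWalk (u zero) (u target) p × length p ≡ 4 + h

  candidate : ∀ {ps a b c d e} → CountedWalk (u zero) (u target) ps a b c d e → a + b + c + d + e ≡ 3 + h →
              Candidate (u zero ∷ ps)
  candidate w total = isWalk w , cong suc (trans (edges w) total)

  candidateA : Candidate geodesicA
  candidateA = candidate walkA (cong (3 +_) (+-identityʳ h))

  candidateB : Candidate geodesicB
  candidateB = candidate walkB (cong (3 +_) (+-identityʳ h))

  candidateC : k ≡ r → Candidate geodesicC
  candidateC k≡r = candidate (walkC k≡r) refl

  inner-A : Any isInner geodesicA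
  inner-A = there (here (zero , refl))

  inner-B : Any isInner geodesicB
  inner-B = there (there (here (zero ⊕ 1 , refl)))

  inner-C : Any isInner geodesicC
  inner-C = there (here (zero , refl))

  two-geodesics : k ≢ r → ExactlyGeodesics 2 (u zero) (u target) × AllGeodesicsUseInner (u zero) (u target)
  two-geodesics k≢r = exactly-geodesics ((A≢B ∷ []) ∷ [] ∷ []) , geodesics-use-inner (inner-A ∷ inner-B ∷ [])
    where
    complete : ∀ q → IsWalk (u zero) (u target) q → length q ≤ 4 + h → q ∈ geodesicA ∷ geodesicB ∷ []
    complete q walk length≤ with short-walks q walk length≤
    ... | inj₁ refl               = here refl
    ... | inj₂ (inj₁ refl)        = there (here refl)
    ... | inj₂ (inj₂ (k≡r , _))   = contradiction k≡r k≢r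
    open Enumeration geodesicA (geodesicB ∷ []) (candidateA ∷ candidateB ∷ []) complete

  three-geodesics : k ≡ r → ExactlyGeodesics 3 (u zero) (u target) × AllGeodesicsUseInner (u zero) (u target)
  three-geodesics k≡r =
    exactly-geodesics ((A≢B ∷ A≢C k≡r ∷ []) ∷ (B≢C ∷ []) ∷ [] ∷ []) , geodesics-use-inner (inner-A ∷ inner-B ∷ inner-C ∷ [])
    where
    complete : ∀ q → IsWalk (u zero) (u target) q → length q ≤ 4 + h → q ∈ geodesicA ∷ geodesicB ∷ geodesicC ∷ []
    complete q walk length≤ with short-walks q walk length≤
    ... | inj₁ refl               = here refl
    ... | inj₂ (inj₁ refl)        = there (here refl)
    ... | inj₂ (inj₂ (_ , refl))  = there (there (here refl))
    open Enumeration geodesicA (geodesicB ∷ geodesicC ∷ [])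
                     (candidateA ∷ candidateB ∷ candidateC k≡r ∷ []) complete

5<1+2h⇒3≤h : ∀ {h} → 5 < suc (2 * h) → 3 ≤ h
5<1+2h⇒3≤h {suc (suc (suc _))} _ = s≤s (s≤s (s≤s z≤n))
5<1+2h⇒3≤h {0}                  (s≤s ())
5<1+2h⇒3≤h {1}                  (s≤s (s≤s (s≤s ())))
5<1+2h⇒3≤h {2}                  (s≤s (s≤s (s≤s (s≤s (s≤s ())))))

GeodesicCount : ℕ → ℕ → ℕ → Set
GeodesicCount k r m =
  ExactlyGeodesics {suc (2 * k)} m (uₙ (suc (2 * k)) 0) (uₙ (suc (2 * k)) r)
  × AllGeodesicsUseInner {suc (2 * k)} (uₙ (suc (2 * k)) 0) (uₙ (suc (2 * k)) r)

mainTheorem13 : (∀ (k r : ℕ) → ¬ (2 ∣ r) → 5 < r → r < k →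
       ExactlyGeodesics {suc (2 * k)} 2 (uₙ (suc (2 * k)) 0) (uₙ (suc (2 * k)) r)
       × AllGeodesicsUseInner {suc (2 * k)} (uₙ (suc (2 * k)) 0) (uₙ (suc (2 * k)) r))
    × (∀ (k r : ℕ) → ¬ (2 ∣ r) → 5 < r → r ≡ k →
       ExactlyGeodesics {suc (2 * k)} 3 (uₙ (suc (2 * k)) 0) (uₙ (suc (2 * k)) r)
       × AllGeodesicsUseInner {suc (2 * k)} (uₙ (suc (2 * k)) 0) (uₙ (suc (2 * k)) r))
mainTheorem13 = below-k , at-k
  where
  below-k : ∀ k r → ¬ 2 ∣ r → 5 < r → r < k → GeodesicCount k r 2
  below-k k r 2∤r 5<r r<k with odd⇒≡1+2* r 2∤r
  ... | h , refl = Geodesics.two-geodesics k h (5<1+2h⇒3≤h 5<r) (<⇒≤ r<k) (≢-sym (<⇒≢ r<k))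
  at-k : ∀ k r → ¬ 2 ∣ r → 5 < r → r ≡ k → GeodesicCount k r 3
  at-k k r 2∤r 5<r refl with odd⇒≡1+2* r 2∤r
  ... | h , refl = Geodesics.three-geodesics r h (5<1+2h⇒3≤h 5<r) ≤-refl refl
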